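{- Let $n\ge 2$ and let $\pi,\pi'\in\mathrm{I}_n$ be involutions such that the transposition $(1,n)$ is not one of the cycles of $\pi$ but is one of the cycles of $\pi'$. If $\pi'=s\cdot\pi$ for some simple transposition $s\in\{s_1,\dots,s_{n-1}\}$, then $s=s_1$ or $s=s_{n-1}$.
   Context: $\mathrm{S}_n$ is the symmetric group on $[n]$, with products being compositions $(uv)(x)=u(v(x))$; $s_k=(k,k+1)$ for $1\le k\le n-1$; $\mathrm{I}_n$ is the set of involutions in $\mathrm{S}_n$. For $\pi\in\mathrm{I}_n$ and $1\le k\le n-1$: $s_k\cdot\pi=\pi$ if $\pi^{ -1}(k+1)<\pi^{ -1}(k)$; $s_k\cdot\pi=s_k\pi$ if $\pi(k)=k$ and $\pi(k+1)=k+1$; $s_k\cdot\pi=s_k\pi s_k$ otherwise. -}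

module Defs where

open import Data.Nat using (ℕ; suc)
open import Data.Fin using (Fin; zero; suc; inject₁; fromℕ; _<?_; _≟_)
open import Data.Product using (_×_)
open import Relation.Binary.PropositionalEquality using (_≡_)
open import Relation.Nullary using (yes; no)

-- Conventions: [n] is represented by Fin n, 0-indexed (element i ↔ i+1).
-- A permutation is a function Fin n → Fin n; involutions are functions with
-- π ∘ π = id pointwise (hence bijective, π⁻¹ = π).

Perm : ℕ → Set
Perm n = Fin n → Fin n

IsInvolution : ∀ {n} → Perm n → Set
IsInvolution {n} π = ∀ (i : Fin n) → π (π i) ≡ i

swap : ∀ {n} → Fin n → Fin n → Perm n
swap a b x with x ≟ a
... | yes _ = b
... | no _ with x ≟ b
...   | yes _ = a
...   | no _ = x

-- simple transposition s_{k+1} = (k+1, k+2) in S_{m+2}, for k : Fin (suc m),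
-- swapping the 0-indexed positions inject₁ k and suc k.
s : ∀ {m} → Fin (suc m) → Perm (suc (suc m))
s k = swap (inject₁ k) (suc k)

_∘ₚ_ : ∀ {n} → Perm n → Perm n → Perm n
(u ∘ₚ v) x = u (v x)

-- the action s_{k+1} · π on involutions (π⁻¹ = π for involutions)
_·_ : ∀ {m} → Fin (suc m) → Perm (suc (suc m)) → Perm (suc (suc m))
(k · π) with π (suc k) <? π (inject₁ k)
... | yes _ = π
... | no _ with π (inject₁ k) ≟ inject₁ k | π (suc k) ≟ suc k
...   | yes _ | yes _ = s k ∘ₚ π
...   | _ | _ = s k ∘ₚ (π ∘ₚ s k)

HasCycle : ∀ {n} → Perm n → Fin n → Fin n → Set
HasCycle π a b = π a ≡ b

-- Away from its support {k, k+1}, the action k · π agrees with π up to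
-- conjugation by s k, which fixes both 0 and n−1.  So if s ∉ {s₁, sₙ₋₁}, the
-- arc 0 ↦ n−1 of π′ = k · π is already an arc of π.
module Submission where

open import Defs
open import Data.Nat using (ℕ; suc)
open import Data.Fin using (Fin; zero; suc; fromℕ; inject₁; _<?_; _≟_)
open import Data.Fin.Properties using (fromℕ≢inject₁; inject₁-injective; suc-injective)
open import Data.Sum using (_⊎_; inj₁; inj₂)
open import Relation.Binary.PropositionalEquality using (_≡_; _≢_; refl; sym; trans; cong)
open import Relation.Nullary using (¬_; yes; no; contradiction)

swap-fixes : ∀ {n} {a b x : Fin n} → x ≢ a → x ≢ b → swap a b x ≡ x
swap-fixes {a = a} {b} {x} x≢a x≢b with x ≟ a
... | yes x≡a = contradiction x≡a x≢a
... | no _ with x ≟ b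
...   | yes x≡b = contradiction x≡b x≢b
...   | no _ = refl

swap-reflects : ∀ {n} {a b x y : Fin n} → y ≢ a → y ≢ b → swap a b x ≡ y → x ≡ y
swap-reflects {a = a} {b} {x} y≢a y≢b eq with x ≟ a
... | yes _ = contradiction (sym eq) y≢b
... | no _ with x ≟ b
...   | yes _ = contradiction (sym eq) y≢a
...   | no _ = eq

swap-conjugate-fixed : ∀ {n} (π : Perm n) {a b x : Fin n} → x ≢ a → x ≢ b →
                       swap a b (π (swap a b x)) ≡ swap a b (π x)
swap-conjugate-fixed π {a} {b} x≢a x≢b = cong (λ z → swap a b (π z)) (swap-fixes x≢a x≢b)

·-reflects-arc : ∀ {m} (π : Perm (suc (suc m))) (k : Fin (suc m)) {x y : Fin (suc (suc m))} →
                 x ≢ inject₁ k → x ≢ suc k → y ≢ inject₁ k → y ≢ suc k →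
                 (k · π) x ≡ y → π x ≡ y
·-reflects-arc π k {x} x≢k x≢k+1 y≢k y≢k+1 eq with π (suc k) <? π (inject₁ k)
... | yes _ = eq
... | no _ with π (inject₁ k) ≟ inject₁ k | π (suc k) ≟ suc k
...   | yes _ | yes _ = swap-reflects y≢k y≢k+1 eq
...   | yes _ | no _  = swap-reflects y≢k y≢k+1 (trans (sym (swap-conjugate-fixed π x≢k x≢k+1)) eq)
...   | no _  | _     = swap-reflects y≢k y≢k+1 (trans (sym (swap-conjugate-fixed π x≢k x≢k+1)) eq)

zero≢inject₁ : ∀ {m} {k : Fin (suc m)} → k ≢ zero → zero ≢ inject₁ k
zero≢inject₁ {k = k} k≢0 eq = k≢0 (inject₁-injective {i = k} {j = zero} (sym eq))

fromℕ≢suc : ∀ {m} {k : Fin (suc m)} → k ≢ fromℕ m → fromℕ (suc m) ≢ suc k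
fromℕ≢suc k≢last eq = k≢last (sym (suc-injective eq))

lemma3p9 : (m : ℕ) (π π′ : Perm (suc (suc m))) →
    IsInvolution π → IsInvolution π′ →
    ¬ HasCycle π zero (fromℕ (suc m)) →
    HasCycle π′ zero (fromℕ (suc m)) →
    (k : Fin (suc m)) → (∀ i → π′ i ≡ (k · π) i) →
    (k ≡ zero) ⊎ (k ≡ fromℕ m)
lemma3p9 m π π′ _ _ ¬arc arc′ k π′≡k·π with k ≟ zero
... | yes k≡0 = inj₁ k≡0
... | no k≢0 with k ≟ fromℕ m
...   | yes k≡last = inj₂ k≡last
...   | no k≢last = contradiction arc ¬arc
  where
  arc : π zero ≡ fromℕ (suc m)
  arc = ·-reflects-arc π k (zero≢inject₁ k≢0) (λ ()) fromℕ≢inject₁ (fromℕ≢suc k≢last)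
                       (trans (sym (π′≡k·π zero)) arc′)
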